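{- Let $n\ge 3$ and let $q$ be a real number with $0<q\le 1/6$. Let $\mathbf P(q)=(P_{ij})_{0\le i,j\le n-1}$ be the $n\times n$ transition probability matrix with entries $P_{00}=1-q,\ P_{01}=q$; $P_{10}=5q,\ P_{11}=1-6q,\ P_{12}=q$; for $2\le i\le n-2$: $P_{i0}=4q,\ P_{i,i-1}=q,\ P_{ii}=1-6q,\ P_{i,i+1}=q$; $P_{n-1,0}=5q,\ P_{n-1,n-2}=q,\ P_{n-1,n-1}=1-6q$; and all other entries $0$. Then the steady state probability vector $\vec\pi=(\pi_0,\dots,\pi_{n-1})$ of $\mathbf P(q)$ is given by $$\pi_i=\frac{B_{n-i}}{\sum_{l=1}^{n}B_l}=\frac{2B_{n-i}}{b_{n+1}},\qquad i=0,1,\dots,n-1.$$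
   Context: The balancing numbers $B_m$ are defined by $B_0=0$, $B_1=1$, $B_{m+1}=6B_m-B_{m-1}$. The cobalancing numbers $b_m$ are defined by $b_0=0$, $b_1=0$, $b_{m+1}=6b_m-b_{m-1}+2$; one has $\sum_{l=1}^n B_l=b_{n+1}/2$. The steady state probability vector of a transition probability matrix $\mathbf P$ is the probability row vector $\vec\pi$ (nonnegative entries summing to $1$) satisfying $\vec\pi=\vec\pi\mathbf P$. -}

module Defs where

open import Level using (Level; suc; _⊔_)
open import Data.Nat as ℕ using (ℕ; zero; _≡ᵇ_; _∸_)
  renaming (suc to 1+)
open import Data.Bool using (if_then_else_)
open import Data.Fin using (Fin; toℕ)
  renaming (zero to fzero; suc to fsuc)
open import Data.Product using (Σ; ∃; _×_)
open import Relation.Nullary using (¬_)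
open import Algebra.Structures using (IsCommutativeRing)
open import Relation.Binary.Structures using (IsTotalOrder)

-- Balancing and cobalancing numbers (natural numbers; the truncated
-- subtraction ∸ is exact here since both sequences are nondecreasing
-- and 6·x_m ≥ x_{m-1}).

B : ℕ → ℕ
B 0 = 0
B 1 = 1
B (1+ (1+ m)) = 6 ℕ.* B (1+ m) ∸ B m

cob : ℕ → ℕ
cob 0 = 0
cob 1 = 0
cob (1+ (1+ m)) = (6 ℕ.* cob (1+ m) ∸ cob m) ℕ.+ 2

sumFrom1 : ℕ → (ℕ → ℕ) → ℕ
sumFrom1 zero f = 0
sumFrom1 (1+ n) f = sumFrom1 n f ℕ.+ f (1+ n)

-- The real numbers, axiomatised as a complete (Dedekind/sup-complete)
-- ordered field.  Every model is isomorphic to ℝ.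

record RealField (c ℓ : Level) : Set (suc (c ⊔ ℓ)) where
  infixl 7 _*_
  infixl 6 _+_ _-_
  infix 4 _≈_ _≤_ _<_
  field
    Carrier : Set c
    _≈_     : Carrier → Carrier → Set ℓ
    _+_     : Carrier → Carrier → Carrier
    _*_     : Carrier → Carrier → Carrier
    -_      : Carrier → Carrier
    0#      : Carrier
    1#      : Carrier
    _⁻¹     : Carrier → Carrier
    _≤_     : Carrier → Carrier → Set ℓ
    isCommutativeRing : IsCommutativeRing _≈_ _+_ _*_ -_ 0# 1#
    0≉1     : ¬ (0# ≈ 1#)
    ⁻¹-inverse : ∀ x → ¬ (x ≈ 0#) → x * (x ⁻¹) ≈ 1#
    ⁻¹-cong : ∀ {x y} → x ≈ y → x ⁻¹ ≈ y ⁻¹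
    isTotalOrder : IsTotalOrder _≈_ _≤_
    +-mono-≤ : ∀ {x y} z → x ≤ y → x + z ≤ y + z
    *-nonneg : ∀ {x y} → 0# ≤ x → 0# ≤ y → 0# ≤ x * y
    complete : (S : Carrier → Set ℓ) → ∃ S →
               (∃ λ u → ∀ x → S x → x ≤ u) →
               ∃ λ s → (∀ x → S x → x ≤ s) ×
                       (∀ u → (∀ x → S x → x ≤ u) → s ≤ u)

  _-_ : Carrier → Carrier → Carrier
  x - y = x + (- y)

  _<_ : Carrier → Carrier → Set ℓ
  x < y = (x ≤ y) × ¬ (x ≈ y)

  _/_ : Carrier → Carrier → Carrier
  x / y = x * (y ⁻¹)

  fromℕ : ℕ → Carrier
  fromℕ zero = 0#
  fromℕ (1+ k) = 1# + fromℕ k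

  ΣFin : (n : ℕ) → (Fin n → Carrier) → Carrier
  ΣFin zero f = 0#
  ΣFin (1+ n) f = f fzero + ΣFin n (λ i → f (fsuc i))

  Pentry : (n : ℕ) → Carrier → ℕ → ℕ → Carrier
  Pentry n q i j =
    if i ≡ᵇ 0 then
      (if j ≡ᵇ 0 then 1# - q else if j ≡ᵇ 1 then q else 0#)
    else if i ≡ᵇ 1 then
      (if j ≡ᵇ 0 then fromℕ 5 * q
       else if j ≡ᵇ 1 then 1# - fromℕ 6 * q
       else if j ≡ᵇ 2 then q else 0#)
    else if i ≡ᵇ (n ∸ 1) then
      (if j ≡ᵇ 0 then fromℕ 5 * q
       else if j ≡ᵇ (n ∸ 2) then q
       else if j ≡ᵇ (n ∸ 1) then 1# - fromℕ 6 * q else 0#)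
    else
      (if j ≡ᵇ 0 then fromℕ 4 * q
       else if j ≡ᵇ (i ∸ 1) then q
       else if j ≡ᵇ i then 1# - fromℕ 6 * q
       else if j ≡ᵇ (1+ i) then q else 0#)

  P : (n : ℕ) → Carrier → Fin n → Fin n → Carrier
  P n q i j = Pentry n q (toℕ i) (toℕ j)

  IsSteadyState : (n : ℕ) → (Fin n → Fin n → Carrier) → (Fin n → Carrier) → Set ℓ
  IsSteadyState n M π =
    (∀ i → 0# ≤ π i) ×
    (ΣFin n π ≈ 1#) ×
    (∀ j → π j ≈ ΣFin n (λ i → π i * M i j))

{-# OPTIONS --safe #-}
-- With the convention π_n = 0, the columns 1, …, n-1 of π = π P(q) all read
-- π_{j-1} q + π_j (1 - 6q) + π_{j+1} q = π_j, i.e. (as q ≠ 0) π_{j-1} + π_{j+1} = 6 π_j: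
-- the balancing recurrence run downwards from π_n = 0.  Hence π_i = B_{n-i} π_{n-1}, and
-- Σ π_i = 1 fixes π_{n-1} = 1 / Σ_{l=1}^{n} B_l.  Conversely this vector satisfies those
-- columns, and column 0 reduces to 5 B_n = B_{n-1} + 1 + 4 Σ_{l=1}^{n} B_l, a consequence of
-- B_{k+1} = B_k + 4 Σ_{l=1}^{k} B_l + 1.  The cobalancing form is b_{n+1} = 2 Σ_{l=1}^{n} B_l.
module Submission where

open import Defs
open import Data.Nat as ℕ using (ℕ; zero; suc; _≡ᵇ_; _∸_; z≤n; s≤s)
import Data.Nat.Properties as ℕ
open import Data.Fin as Fin using (Fin; toℕ) renaming (zero to fzero; suc to fsuc)
import Data.Fin.Properties as Fin
open import Data.Bool using (true; false; if_then_else_; T)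
open import Data.Unit using (tt)
open import Data.Maybe using (Maybe; just; nothing)
open import Data.Product using (_×_; _,_; proj₁; proj₂)
open import Data.Sum using (inj₁; inj₂)
open import Relation.Nullary using (¬_; yes; no; contradiction)
open import Relation.Binary.PropositionalEquality as ≡ using (_≡_)
open import Relation.Binary.Structures using (IsTotalOrder)
open import Algebra.Bundles using (CommutativeRing)
open import Algebra.Solver.Ring.AlmostCommutativeRing
  using (fromCommutativeRing; _-Raw-AlmostCommutative⟶_)

module BalancingNumbers where
  open import Data.Nat
  open import Data.Nat.Properties
  open import Relation.Binary.PropositionalEquality
  open import Data.Nat.Solver using (module +-*-Solver)
  open +-*-Solver

  ΣB : ℕ → ℕ
  ΣB n = sumFrom1 n B

  B-mono : ∀ k → B k ≤ B (1 + k)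
  B-rec : ∀ k → B (2 + k) + B k ≡ 6 * B (1 + k)

  B-mono 0 = z≤n
  B-mono 1 = s≤s z≤n
  B-mono (suc (suc k)) = +-cancelʳ-≤ (B (1 + k)) _ _ (begin
    B (2 + k) + B (1 + k)               ≤⟨ +-monoʳ-≤ (B (2 + k)) (B-mono (suc k)) ⟩
    B (2 + k) + B (2 + k)               ≤⟨ +-monoʳ-≤ (B (2 + k)) (m≤m+n (B (2 + k)) (4 * B (2 + k))) ⟩
    6 * B (2 + k)                       ≡⟨ B-rec (suc k) ⟨
    B (3 + k) + B (1 + k)               ∎)
    where open ≤-Reasoning

  B-rec k = m∸n+n≡m (≤-trans (B-mono k) (m≤n*m (B (1 + k)) 6))

  B-suc : ∀ k → B (1 + k) ≡ B k + 4 * ΣB k + 1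
  B-suc zero = refl
  B-suc (suc k) = +-cancelʳ-≡ (B k) _ _ (begin
    B (2 + k) + B k                     ≡⟨ B-rec k ⟩
    6 * x                               ≡⟨ solve 1 (λ x → con 6 :* x := con 5 :* x :+ x) refl x ⟩
    5 * x + x                           ≡⟨ cong (5 * x +_) (B-suc k) ⟩
    5 * x + (B k + 4 * ΣB k + 1)        ≡⟨ solve 3 (λ x b s → con 5 :* x :+ (b :+ con 4 :* s :+ con 1)
                                                           := (x :+ con 4 :* (s :+ x) :+ con 1) :+ b) refl x (B k) (ΣB k) ⟩
    x + 4 * ΣB (1 + k) + 1 + B k        ∎)
    where
    open ≡-Reasoning
    x = B (1 + k)

  5*B-suc : ∀ k → 5 * B (1 + k) ≡ B k + 1 + 4 * ΣB (1 + k)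
  5*B-suc k = begin
    5 * x                               ≡⟨ solve 1 (λ x → con 5 :* x := x :+ con 4 :* x) refl x ⟩
    x + 4 * x                           ≡⟨ cong (_+ 4 * x) (B-suc k) ⟩
    B k + 4 * ΣB k + 1 + 4 * x          ≡⟨ solve 3 (λ b s x → b :+ con 4 :* s :+ con 1 :+ con 4 :* x
                                                           := b :+ con 1 :+ con 4 :* (s :+ x)) refl (B k) (ΣB k) x ⟩
    B k + 1 + 4 * ΣB (1 + k)            ∎
    where
    open ≡-Reasoning
    x = B (1 + k)

  cob-suc : ∀ k → cob (1 + k) ≡ 2 * ΣB k
  cob-suc 0 = refl
  cob-suc 1 = refl
  cob-suc (suc (suc k)) = begin
    6 * cob (2 + k) ∸ cob (1 + k) + 2   ≡⟨ cong₂ (λ u v → 6 * u ∸ v + 2) (cob-suc (suc k)) (cob-suc k) ⟩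
    6 * (2 * (s + x)) ∸ 2 * s + 2       ≡⟨ cong (λ u → u ∸ 2 * s + 2) (solve 2 (λ s x → con 6 :* (con 2 :* (s :+ x))
                                                           := (con 10 :* s :+ con 12 :* x) :+ con 2 :* s) refl s x) ⟩
    10 * s + 12 * x + 2 * s ∸ 2 * s + 2 ≡⟨ cong (_+ 2) (m+n∸n≡m (10 * s + 12 * x) (2 * s)) ⟩
    10 * s + 12 * x + 2                 ≡⟨ solve 2 (λ s x → con 10 :* s :+ con 12 :* x :+ con 2
                                                  := con 2 :* ((s :+ x) :+ (x :+ con 4 :* (s :+ x) :+ con 1))) refl s x ⟩
    2 * (ΣB (1 + k) + (x + 4 * ΣB (1 + k) + 1)) ≡⟨ cong (λ u → 2 * (ΣB (1 + k) + u)) (B-suc (suc k)) ⟨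
    2 * ΣB (2 + k)                      ∎
    where
    open ≡-Reasoning
    s = ΣB k
    x = B (1 + k)

  ΣB-pos : ∀ k → 1 ≤ ΣB (1 + k)
  ΣB-pos k = ≤-trans (B-pos k) (m≤n+m (B (1 + k)) (ΣB k))
    where
    B-pos : ∀ k → 1 ≤ B (1 + k)
    B-pos zero = s≤s z≤n
    B-pos (suc k) = ≤-trans (B-pos k) (B-mono (suc k))

≡ᵇ-sym : ∀ m n → (m ≡ᵇ n) ≡ (n ≡ᵇ m)
≡ᵇ-sym zero zero = ≡.refl
≡ᵇ-sym zero (suc n) = ≡.refl
≡ᵇ-sym (suc m) zero = ≡.refl
≡ᵇ-sym (suc m) (suc n) = ≡ᵇ-sym m n

<⇒≡ᵇ-false : ∀ {m n} → m ℕ.< n → (m ≡ᵇ n) ≡ false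
<⇒≡ᵇ-false {zero} (s≤s _) = ≡.refl
<⇒≡ᵇ-false {suc m} (s≤s m<n@(s≤s _)) = <⇒≡ᵇ-false m<n

≡ᵇ-true⇒≡ : ∀ m n → (m ≡ᵇ n) ≡ true → m ≡ n
≡ᵇ-true⇒≡ m n eq = ℕ.≡ᵇ⇒≡ m n (≡.subst T (≡.sym eq) tt)

extend : ∀ {a} {A : Set a} → A → ∀ {n} → (Fin n → A) → ℕ → A
extend d {zero} v k = d
extend d {suc n} v zero = v fzero
extend d {suc n} v (suc k) = extend d (λ i → v (fsuc i)) k

extend-toℕ : ∀ {a} {A : Set a} (d : A) {n} (v : Fin n → A) i → extend d v (toℕ i) ≡ v i
extend-toℕ d v fzero = ≡.refl
extend-toℕ d v (fsuc i) = extend-toℕ d (λ i → v (fsuc i)) i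

extend-n : ∀ {a} {A : Set a} (d : A) {n} (v : Fin n → A) → extend d v n ≡ d
extend-n d {zero} v = ≡.refl
extend-n d {suc n} v = extend-n d (λ i → v (fsuc i))

module OrderedFieldProperties {c ℓ} (R : RealField c ℓ) where
  open import Data.Integer as ℤ using (ℤ; +_; -[1+_]; sign; ∣_∣; _◃_; _⊖_)
  import Data.Integer.Properties as ℤ
  open import Data.Sign as Sign using (Sign)

  open RealField R

  commutativeRing : CommutativeRing c ℓ
  commutativeRing = record { isCommutativeRing = isCommutativeRing }

  open CommutativeRing commutativeRing public
    using ( refl; sym; trans; reflexive; setoid; ring
          ; +-cong; +-congˡ; +-congʳ; *-cong; *-congˡ; *-congʳ
          ; +-assoc; +-comm; +-identityˡ; +-identityʳ; *-assoc; *-comm; *-identityˡ; *-identityʳ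
          ; zeroˡ; zeroʳ; distribʳ; -‿cong; -‿inverseˡ; -‿inverseʳ
          ; +-commutativeSemigroup; *-commutativeSemigroup; +-abelianGroup )
  open import Algebra.Properties.Ring ring public
    using (-0#≈0#; -‿involutive; -‿+-comm; -1*x≈-x; -‿distribʳ-*)
  open import Algebra.Properties.AbelianGroup +-abelianGroup public
    using () renaming ( ∙-cancelʳ to +-cancelʳ
                      ; x∙y⁻¹≈ε⇒x≈y to x-y≈0⇒x≈y; x≈y⇒x∙y⁻¹≈ε to x≈y⇒x-y≈0 )
  open import Algebra.Properties.CommutativeSemigroup +-commutativeSemigroup public
    using () renaming (interchange to +-interchange)
  open import Algebra.Properties.CommutativeSemigroup *-commutativeSemigroup public
    using () renaming (interchange to *-interchange)
  open import Relation.Binary.Reasoning.Setoid setoid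

  fromℕ-+ : ∀ m n → fromℕ (m ℕ.+ n) ≈ fromℕ m + fromℕ n
  fromℕ-+ zero n = sym (+-identityˡ _)
  fromℕ-+ (suc m) n = trans (+-congˡ (fromℕ-+ m n)) (sym (+-assoc _ _ _))

  fromℕ-* : ∀ m n → fromℕ (m ℕ.* n) ≈ fromℕ m * fromℕ n
  fromℕ-* zero n = sym (zeroˡ _)
  fromℕ-* (suc m) n = begin
    fromℕ (n ℕ.+ m ℕ.* n)               ≈⟨ trans (fromℕ-+ n (m ℕ.* n)) (+-congˡ (fromℕ-* m n)) ⟩
    fromℕ n + fromℕ m * fromℕ n         ≈⟨ +-congʳ (*-identityˡ _) ⟨
    1# * fromℕ n + fromℕ m * fromℕ n    ≈⟨ distribʳ _ _ _ ⟨
    (1# + fromℕ m) * fromℕ n            ∎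

  fromℤ : ℤ → Carrier
  fromℤ (+ n) = fromℕ n
  fromℤ -[1+ n ] = - fromℕ (suc n)

  fromℤ-⊖ : ∀ m n → fromℤ (m ⊖ n) ≈ fromℕ m - fromℕ n
  fromℤ-⊖ m zero = sym (trans (+-congˡ -0#≈0#) (+-identityʳ _))
  fromℤ-⊖ zero (suc n) = sym (+-identityˡ _)
  fromℤ-⊖ (suc m) (suc n) = begin
    fromℤ (suc m ⊖ suc n)                   ≡⟨ ≡.cong fromℤ (ℤ.[1+m]⊖[1+n]≡m⊖n m n) ⟩
    fromℤ (m ⊖ n)                           ≈⟨ fromℤ-⊖ m n ⟩
    fromℕ m - fromℕ n                       ≈⟨ +-identityˡ _ ⟨
    0# + (fromℕ m - fromℕ n)                ≈⟨ +-congʳ (-‿inverseʳ 1#) ⟨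
    (1# - 1#) + (fromℕ m - fromℕ n)         ≈⟨ +-interchange _ _ _ _ ⟨
    (1# + fromℕ m) + (- 1# + - fromℕ n)     ≈⟨ +-congˡ (-‿+-comm 1# (fromℕ n)) ⟩
    fromℕ (suc m) - fromℕ (suc n)           ∎

  fromℤ-+ : ∀ i j → fromℤ (i ℤ.+ j) ≈ fromℤ i + fromℤ j
  fromℤ-+ (+ m) (+ n) = fromℕ-+ m n
  fromℤ-+ (+ m) -[1+ n ] = fromℤ-⊖ m (suc n)
  fromℤ-+ -[1+ m ] (+ n) = trans (fromℤ-⊖ n (suc m)) (+-comm _ _)
  fromℤ-+ -[1+ m ] -[1+ n ] = begin
    - fromℕ (suc (suc (m ℕ.+ n)))           ≡⟨ ≡.cong (λ k → - fromℕ (suc k)) (ℕ.+-suc m n) ⟨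
    - fromℕ (suc m ℕ.+ suc n)               ≈⟨ -‿cong (fromℕ-+ (suc m) (suc n)) ⟩
    - (fromℕ (suc m) + fromℕ (suc n))       ≈⟨ -‿+-comm _ _ ⟨
    - fromℕ (suc m) + - fromℕ (suc n)       ∎

  fromℤ-neg : ∀ i → fromℤ (ℤ.- i) ≈ - fromℤ i
  fromℤ-neg (+ zero) = sym -0#≈0#
  fromℤ-neg (+ suc n) = refl
  fromℤ-neg -[1+ n ] = sym (-‿involutive _)

  fromSign : Sign → Carrier
  fromSign Sign.+ = 1#
  fromSign Sign.- = - 1#

  fromSign-* : ∀ s t → fromSign (s Sign.* t) ≈ fromSign s * fromSign t
  fromSign-* Sign.+ t = sym (*-identityˡ _)
  fromSign-* Sign.- Sign.+ = sym (*-identityʳ _)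
  fromSign-* Sign.- Sign.- = sym (trans (-1*x≈-x _) (-‿involutive _))

  fromℤ-◃ : ∀ s n → fromℤ (s ◃ n) ≈ fromSign s * fromℕ n
  fromℤ-◃ s zero = sym (zeroʳ _)
  fromℤ-◃ Sign.+ (suc n) = sym (*-identityˡ _)
  fromℤ-◃ Sign.- (suc n) = sym (-1*x≈-x _)

  fromℤ-signAbs : ∀ i → fromℤ i ≈ fromSign (sign i) * fromℕ ∣ i ∣
  fromℤ-signAbs i = trans (reflexive (≡.cong fromℤ (≡.sym (ℤ.◃-inverse i)))) (fromℤ-◃ (sign i) ∣ i ∣)

  fromℤ-* : ∀ i j → fromℤ (i ℤ.* j) ≈ fromℤ i * fromℤ j
  fromℤ-* i j = begin
    fromℤ (sign i Sign.* sign j ◃ ∣ i ∣ ℕ.* ∣ j ∣)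
      ≈⟨ fromℤ-◃ (sign i Sign.* sign j) (∣ i ∣ ℕ.* ∣ j ∣) ⟩
    fromSign (sign i Sign.* sign j) * fromℕ (∣ i ∣ ℕ.* ∣ j ∣)
      ≈⟨ *-cong (fromSign-* (sign i) (sign j)) (fromℕ-* ∣ i ∣ ∣ j ∣) ⟩
    (fromSign (sign i) * fromSign (sign j)) * (fromℕ ∣ i ∣ * fromℕ ∣ j ∣)
      ≈⟨ *-interchange _ _ _ _ ⟩
    (fromSign (sign i) * fromℕ ∣ i ∣) * (fromSign (sign j) * fromℕ ∣ j ∣)
      ≈⟨ *-cong (fromℤ-signAbs i) (fromℤ-signAbs j) ⟨
    fromℤ i * fromℤ j
      ∎

  -- The coefficient 1 is read as 1# itself rather than as fromℕ 1 = 1# + 0#, so that goals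
  -- mentioning both 1# and the literals fromℕ k are instances of solver equations.
  coeff : ℤ → Carrier
  coeff (+ 1) = 1#
  coeff i = fromℤ i

  coeff≈fromℤ : ∀ i → coeff i ≈ fromℤ i
  coeff≈fromℤ (+ 0) = refl
  coeff≈fromℤ (+ 1) = sym (+-identityʳ 1#)
  coeff≈fromℤ (+ suc (suc n)) = refl
  coeff≈fromℤ -[1+ n ] = refl

  private
    via-fromℤ₁ : ∀ {f : ℤ → ℤ} {g : Carrier → Carrier} → (∀ {x y} → x ≈ y → g x ≈ g y) →
            (∀ i → fromℤ (f i) ≈ g (fromℤ i)) → ∀ i → coeff (f i) ≈ g (coeff i)
    via-fromℤ₁ {f} g-cong h i = trans (coeff≈fromℤ (f i)) (trans (h i) (g-cong (sym (coeff≈fromℤ i))))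

    via-fromℤ₂ : ∀ {f : ℤ → ℤ → ℤ} {g : Carrier → Carrier → Carrier} →
            (∀ {x y u v} → x ≈ y → u ≈ v → g x u ≈ g y v) →
            (∀ i j → fromℤ (f i j) ≈ g (fromℤ i) (fromℤ j)) → ∀ i j → coeff (f i j) ≈ g (coeff i) (coeff j)
    via-fromℤ₂ {f} g-cong h i j =
      trans (coeff≈fromℤ (f i j)) (trans (h i j) (g-cong (sym (coeff≈fromℤ i)) (sym (coeff≈fromℤ j))))

  homomorphism : ℤ.+-*-rawRing -Raw-AlmostCommutative⟶ fromCommutativeRing commutativeRing
  homomorphism = record
    { ⟦_⟧ = coeff
    ; +-homo = via-fromℤ₂ {ℤ._+_} {_+_} +-cong fromℤ-+
    ; *-homo = via-fromℤ₂ {ℤ._*_} {_*_} *-cong fromℤ-*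
    ; -‿homo = via-fromℤ₁ {ℤ.-_} { -_} -‿cong fromℤ-neg
    ; 0-homo = refl
    ; 1-homo = refl
    }

  coeff-≟ : ∀ i j → Maybe (coeff i ≈ coeff j)
  coeff-≟ i j with i ℤ.≟ j
  ... | yes i≡j = just (reflexive (≡.cong coeff i≡j))
  ... | no _ = nothing

  open import Algebra.Solver.Ring ℤ.+-*-rawRing (fromCommutativeRing commutativeRing) homomorphism coeff-≟ public

  *-distribˡ-+₃ : ∀ x a b c → x * (a + b + c) ≈ x * a + x * b + x * c
  *-distribˡ-+₃ = solve 4 (λ x a b c → x :* (a :+ b :+ c) := x :* a :+ x :* b :+ x :* c) refl

  *-distribˡ-+₄ : ∀ x a b c d → x * (a + b + c + d) ≈ x * a + x * b + x * c + x * d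
  *-distribˡ-+₄ = solve 5 (λ x a b c d → x :* (a :+ b :+ c :+ d) := x :* a :+ x :* b :+ x :* c :+ x :* d) refl


  open IsTotalOrder isTotalOrder
    using (total; antisym)
    renaming (refl to ≤-refl; trans to ≤-trans; ≲-respˡ-≈ to ≤-respˡ-≈; ≲-respʳ-≈ to ≤-respʳ-≈)

  x≤0⇒0≤-x : ∀ {x} → x ≤ 0# → 0# ≤ - x
  x≤0⇒0≤-x {x} x≤0 = ≤-respʳ-≈ (+-identityˡ _) (≤-respˡ-≈ (-‿inverseʳ x) (+-mono-≤ (- x) x≤0))

  0≤-x⇒x≤0 : ∀ {x} → 0# ≤ - x → x ≤ 0#
  0≤-x⇒x≤0 {x} 0≤-x = ≤-respʳ-≈ (-‿inverseˡ x) (≤-respˡ-≈ (+-identityˡ x) (+-mono-≤ x 0≤-x))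

  -- If 1# ≤ 0# then 1# = (-1#)·(-1#) would be a product of nonnegatives.
  0≤1 : 0# ≤ 1#
  0≤1 with total 0# 1#
  ... | inj₁ 0≤1 = 0≤1
  ... | inj₂ 1≤0 = ≤-respʳ-≈ (trans (-1*x≈-x (- 1#)) (-‿involutive 1#))
                     (*-nonneg (x≤0⇒0≤-x 1≤0) (x≤0⇒0≤-x 1≤0))

  0≤fromℕ : ∀ n → 0# ≤ fromℕ n
  1≤fromℕ-suc : ∀ n → 1# ≤ fromℕ (suc n)

  0≤fromℕ zero = ≤-refl
  0≤fromℕ (suc n) = ≤-trans 0≤1 (1≤fromℕ-suc n)

  1≤fromℕ-suc n = ≤-respˡ-≈ (+-identityˡ 1#) (≤-respʳ-≈ (+-comm _ _) (+-mono-≤ 1# (0≤fromℕ n)))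

  1≤n⇒fromℕ≉0 : ∀ {n} → 1 ℕ.≤ n → ¬ (fromℕ n ≈ 0#)
  1≤n⇒fromℕ≉0 {suc n} _ fromℕ≈0 = 0≉1 (antisym 0≤1 (≤-respʳ-≈ fromℕ≈0 (1≤fromℕ-suc n)))

  x≉0⇒x⁻¹*x≈1 : ∀ {x} → ¬ (x ≈ 0#) → x ⁻¹ * x ≈ 1#
  x≉0⇒x⁻¹*x≈1 {x} x≉0 = trans (*-comm _ _) (⁻¹-inverse x x≉0)

  x≉0∧x*y≈0⇒y≈0 : ∀ {x y} → ¬ (x ≈ 0#) → x * y ≈ 0# → y ≈ 0#
  x≉0∧x*y≈0⇒y≈0 {x} {y} x≉0 x*y≈0 = begin
    y                   ≈⟨ *-identityˡ y ⟨
    1# * y              ≈⟨ *-congʳ (x≉0⇒x⁻¹*x≈1 x≉0) ⟨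
    (x ⁻¹ * x) * y      ≈⟨ *-assoc _ _ _ ⟩
    x ⁻¹ * (x * y)      ≈⟨ *-congˡ x*y≈0 ⟩
    x ⁻¹ * 0#           ≈⟨ zeroʳ _ ⟩
    0#                  ∎

  ⁻¹-unique : ∀ {x y} → ¬ (x ≈ 0#) → y * x ≈ 1# → y ≈ x ⁻¹
  ⁻¹-unique {x} {y} x≉0 y*x≈1 = begin
    y                   ≈⟨ *-identityʳ y ⟨
    y * 1#              ≈⟨ *-congˡ (⁻¹-inverse x x≉0) ⟨
    y * (x * x ⁻¹)      ≈⟨ *-assoc _ _ _ ⟨
    (y * x) * x ⁻¹      ≈⟨ *-congʳ y*x≈1 ⟩
    1# * x ⁻¹           ≈⟨ *-identityˡ _ ⟩
    x ⁻¹                ∎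

  0≤x⇒0≤x⁻¹ : ∀ {x} → 0# ≤ x → ¬ (x ≈ 0#) → 0# ≤ x ⁻¹
  0≤x⇒0≤x⁻¹ {x} 0≤x x≉0 with total 0# (x ⁻¹)
  ... | inj₁ 0≤x⁻¹ = 0≤x⁻¹
  ... | inj₂ x⁻¹≤0 = contradiction (antisym 0≤1 (0≤-x⇒x≤0 0≤-1)) 0≉1
    where
    0≤-1 : 0# ≤ - 1#
    0≤-1 = ≤-respʳ-≈ (trans (sym (-‿distribʳ-* x (x ⁻¹))) (-‿cong (⁻¹-inverse x x≉0)))
             (*-nonneg 0≤x (x≤0⇒0≤-x x⁻¹≤0))

  *-cancelˡ-/ : ∀ {x y} a → ¬ (x ≈ 0#) → ¬ (y ≈ 0#) → (x * a) / (x * y) ≈ a / y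
  *-cancelˡ-/ {x} {y} a x≉0 y≉0 = begin
    (x * a) * (x * y) ⁻¹      ≈⟨ solve 3 (λ x a z → (x :* a) :* z := a :* (x :* z)) refl x a ((x * y) ⁻¹) ⟩
    a * (x * (x * y) ⁻¹)      ≈⟨ *-congˡ (⁻¹-unique y≉0 x*[xy]⁻¹*y≈1) ⟩
    a * y ⁻¹                  ∎
    where
    x*y≉0 : ¬ (x * y ≈ 0#)
    x*y≉0 x*y≈0 = y≉0 (x≉0∧x*y≈0⇒y≈0 x≉0 x*y≈0)

    x*[xy]⁻¹*y≈1 : x * (x * y) ⁻¹ * y ≈ 1#
    x*[xy]⁻¹*y≈1 = trans (solve 3 (λ x y z → x :* z :* y := (x :* y) :* z) refl x y ((x * y) ⁻¹))
                         (⁻¹-inverse (x * y) x*y≉0)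

module StationaryDistribution {c ℓ} (R : RealField c ℓ) where
  open import Data.Integer using (+_)

  open RealField R
  open OrderedFieldProperties R
  open BalancingNumbers
  open import Relation.Binary.Reasoning.Setoid setoid

  ΣFin-cong : ∀ n {f g : Fin n → Carrier} → (∀ i → f i ≈ g i) → ΣFin n f ≈ ΣFin n g
  ΣFin-cong zero f≈g = refl
  ΣFin-cong (suc n) f≈g = +-cong (f≈g fzero) (ΣFin-cong n (λ i → f≈g (fsuc i)))

  ΣFin-+ : ∀ n (f g : Fin n → Carrier) → ΣFin n (λ i → f i + g i) ≈ ΣFin n f + ΣFin n g
  ΣFin-+ zero f g = sym (+-identityˡ 0#)
  ΣFin-+ (suc n) f g = trans (+-congˡ (ΣFin-+ n _ _)) (+-interchange _ _ _ _)

  ΣFin-+₃ : ∀ n (f g h : Fin n → Carrier) →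
            ΣFin n (λ i → f i + g i + h i) ≈ ΣFin n f + ΣFin n g + ΣFin n h
  ΣFin-+₃ n f g h = trans (ΣFin-+ n (λ i → f i + g i) h) (+-congʳ (ΣFin-+ n f g))

  ΣFin-*ʳ : ∀ n (f : Fin n → Carrier) x → ΣFin n (λ i → f i * x) ≈ ΣFin n f * x
  ΣFin-*ʳ zero f x = sym (zeroˡ x)
  ΣFin-*ʳ (suc n) f x = trans (+-congˡ (ΣFin-*ʳ n _ x)) (sym (distribʳ _ _ _))

  ΣFin-0 : ∀ n → ΣFin n (λ _ → 0#) ≈ 0#
  ΣFin-0 zero = refl
  ΣFin-0 (suc n) = trans (+-identityˡ _) (ΣFin-0 n)

  fromℕ-B-rec : ∀ t → fromℕ (B (2 ℕ.+ t)) + fromℕ (B t) ≈ fromℕ 6 * fromℕ (B (1 ℕ.+ t))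
  fromℕ-B-rec t = trans (sym (fromℕ-+ (B (2 ℕ.+ t)) (B t)))
                        (trans (reflexive (≡.cong fromℕ (B-rec t))) (fromℕ-* 6 (B (1 ℕ.+ t))))

  ΣFin-B : ∀ n → ΣFin n (λ i → fromℕ (B (n ∸ toℕ i))) ≈ fromℕ (ΣB n)
  ΣFin-B zero = refl
  ΣFin-B (suc n) = trans (+-congˡ (ΣFin-B n)) (trans (+-comm _ _) (sym (fromℕ-+ (ΣB n) (B (suc n)))))

  -- The test is written a ≡ᵇ k, as in Pentry, so that the columns of P split
  -- into such indicators by unfolding _≡ᵇ_ alone.
  δ : ℕ → ℕ → Carrier → Carrier
  δ k a x = if a ≡ᵇ k then x else 0#

  ΣFin-*δ : ∀ n (f : ℕ → Carrier) a x → a ℕ.< n → ΣFin n (λ i → f (toℕ i) * δ (toℕ i) a x) ≈ f a * x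
  ΣFin-*δ (suc n) f zero x _ = begin
    f 0 * x + ΣFin n (λ i → f (suc (toℕ i)) * 0#)  ≈⟨ +-congˡ (ΣFin-cong n (λ i → zeroʳ _)) ⟩
    f 0 * x + ΣFin n (λ _ → 0#)                    ≈⟨ +-congˡ (ΣFin-0 n) ⟩
    f 0 * x + 0#                                   ≈⟨ +-identityʳ _ ⟩
    f 0 * x                                        ∎
  ΣFin-*δ (suc n) f (suc a) x (s≤s a<n) =
    trans (+-cong (zeroʳ _) (ΣFin-*δ n (λ k → f (suc k)) a x a<n)) (+-identityˡ _)

  ΣFin-*δ-out : ∀ n (f : ℕ → Carrier) x → ΣFin n (λ i → f (toℕ i) * δ (toℕ i) n x) ≈ 0#
  ΣFin-*δ-out zero f x = refl
  ΣFin-*δ-out (suc n) f x = trans (+-cong (zeroʳ _) (ΣFin-*δ-out n (λ k → f (suc k)) x)) (+-identityˡ _)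

  ΣFin-*δ-≤ : ∀ n (f : ℕ → Carrier) a x → a ℕ.≤ n → f n ≈ 0# →
              ΣFin n (λ i → f (toℕ i) * δ (toℕ i) a x) ≈ f a * x
  ΣFin-*δ-≤ n f a x a≤n fn≈0 with ℕ.m≤n⇒m<n∨m≡n a≤n
  ... | inj₁ a<n = ΣFin-*δ n f a x a<n
  ... | inj₂ ≡.refl = trans (ΣFin-*δ-out n f x) (sym (trans (*-congʳ fn≈0) (zeroˡ x)))

  if-≡ᵇ-chain₂ : ∀ n a x y →
    (if n ≡ᵇ a then x else if n ≡ᵇ suc a then y else 0#) ≈ δ (suc a) n y + δ a n x
  if-≡ᵇ-chain₂ zero zero x y = sym (+-identityˡ x)
  if-≡ᵇ-chain₂ zero (suc a) x y = sym (+-identityˡ 0#)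
  if-≡ᵇ-chain₂ (suc n) zero x y = sym (+-identityʳ _)
  if-≡ᵇ-chain₂ (suc n) (suc a) x y = if-≡ᵇ-chain₂ n a x y

  if-≡ᵇ-chain₃ : ∀ n a x y z →
    (if n ≡ᵇ a then x else if n ≡ᵇ suc a then y else if n ≡ᵇ suc (suc a) then z else 0#) ≈
    δ (suc (suc a)) n z + δ (suc a) n y + δ a n x
  if-≡ᵇ-chain₃ zero zero x y z = solve 1 (λ x → x := con (+ 0) :+ con (+ 0) :+ x) refl x
  if-≡ᵇ-chain₃ zero (suc a) x y z = solve 0 (con (+ 0) := con (+ 0) :+ con (+ 0) :+ con (+ 0)) refl
  if-≡ᵇ-chain₃ (suc n) zero x y z = trans (if-≡ᵇ-chain₂ n 0 y z) (sym (+-identityʳ _))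
  if-≡ᵇ-chain₃ (suc n) (suc a) x y z = if-≡ᵇ-chain₃ n a x y z

  column-identity : ∀ a b c q → a * q + b * (1# - fromℕ 6 * q) + c * q ≈ b + (a + c - fromℕ 6 * b) * q
  column-identity = solve 4 (λ a b c q → a :* q :+ b :* (con (+ 1) :- con (+ 6) :* q) :+ c :* q
                                         := b :+ (a :+ c :- con (+ 6) :* b) :* q) refl

  balanced⇒column : ∀ {a b c} q → a + c ≈ fromℕ 6 * b → b ≈ a * q + b * (1# - fromℕ 6 * q) + c * q
  balanced⇒column {a} {b} {c} q a+c≈6b = sym (begin
    a * q + b * (1# - fromℕ 6 * q) + c * q   ≈⟨ column-identity a b c q ⟩
    b + (a + c - fromℕ 6 * b) * q            ≈⟨ +-congˡ (*-congʳ (x≈y⇒x-y≈0 a+c≈6b)) ⟩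
    b + 0# * q                               ≈⟨ solve 2 (λ b q → b :+ con (+ 0) :* q := b) refl b q ⟩
    b                                        ∎)

  column⇒balanced : ∀ {a b c q} → ¬ (q ≈ 0#) →
    b ≈ a * q + b * (1# - fromℕ 6 * q) + c * q → a + c ≈ fromℕ 6 * b
  column⇒balanced {a} {b} {c} {q} q≉0 column = x-y≈0⇒x≈y (a + c) (fromℕ 6 * b)
    (x≉0∧x*y≈0⇒y≈0 q≉0 (begin
      q * (a + c - fromℕ 6 * b)
        ≈⟨ solve 4 (λ a b c q → q :* (a :+ c :- con (+ 6) :* b)
                                := b :+ (a :+ c :- con (+ 6) :* b) :* q :- b) refl a b c q ⟩
      b + (a + c - fromℕ 6 * b) * q - b
        ≈⟨ +-congʳ (trans (sym (column-identity a b c q)) (sym column)) ⟩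
      b - b
        ≈⟨ -‿inverseʳ b ⟩
      0#
        ∎))

  first-column-balance : ∀ {a b o σ t s} q → σ ≈ t * s → fromℕ 5 * a ≈ b + o + fromℕ 4 * t →
    a * s ≈ σ * (fromℕ 4 * q) + a * s * (1# - fromℕ 5 * q) + b * s * q + o * s * q
  first-column-balance {a} {b} {o} {σ} {t} {s} q σ≈ts 5a≈b+o+4t = sym (begin
    σ * (fromℕ 4 * q) + a * s * (1# - fromℕ 5 * q) + b * s * q + o * s * q
      ≈⟨ solve 7 (λ a b o σ t s q →
                   σ :* (con (+ 4) :* q) :+ a :* s :* (con (+ 1) :- con (+ 5) :* q) :+ b :* s :* q :+ o :* s :* q
                   := a :* s :+ q :* s :* (b :+ o :+ con (+ 4) :* t :- con (+ 5) :* a) :+ con (+ 4) :* q :* (σ :- t :* s))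
                 refl a b o σ t s q ⟩
    a * s + q * s * (b + o + fromℕ 4 * t - fromℕ 5 * a) + fromℕ 4 * q * (σ - t * s)
      ≈⟨ +-cong (+-congˡ (*-congˡ (x≈y⇒x-y≈0 (sym 5a≈b+o+4t)))) (*-congˡ (x≈y⇒x-y≈0 σ≈ts)) ⟩
    a * s + q * s * 0# + fromℕ 4 * q * 0#
      ≈⟨ solve 3 (λ x y z → x :+ y :* con (+ 0) :+ z :* con (+ 0) := x) refl (a * s) (q * s) (fromℕ 4 * q) ⟩
    a * s
      ∎)

  balancing-recurrence : ∀ {L} (h : ℕ → Carrier) → h 0 ≈ 0# →
    (∀ t → 2 ℕ.+ t ℕ.≤ L → h (2 ℕ.+ t) + h t ≈ fromℕ 6 * h (1 ℕ.+ t)) →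
    ∀ t → t ℕ.≤ L → h t ≈ fromℕ (B t) * h 1
  balancing-recurrence h h0≈0 rec zero _ = trans h0≈0 (sym (zeroˡ _))
  balancing-recurrence h h0≈0 rec (suc zero) _ = sym (trans (*-congʳ (+-identityʳ 1#)) (*-identityˡ _))
  balancing-recurrence h h0≈0 rec (suc (suc t)) t+2≤L = +-cancelʳ (Bh t) _ _ (begin
    h (2 ℕ.+ t) + Bh t                              ≈⟨ +-congˡ (IH t (ℕ.m+n≤o⇒n≤o 2 t+2≤L)) ⟨
    h (2 ℕ.+ t) + h t                               ≈⟨ rec t t+2≤L ⟩
    fromℕ 6 * h (1 ℕ.+ t)                           ≈⟨ *-congˡ (IH (suc t) (ℕ.m+n≤o⇒n≤o 1 t+2≤L)) ⟩
    fromℕ 6 * Bh (1 ℕ.+ t)                          ≈⟨ *-assoc _ _ _ ⟨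
    fromℕ 6 * fromℕ (B (1 ℕ.+ t)) * h 1             ≈⟨ *-congʳ (fromℕ-B-rec t) ⟨
    (fromℕ (B (2 ℕ.+ t)) + fromℕ (B t)) * h 1       ≈⟨ distribʳ _ _ _ ⟩
    Bh (2 ℕ.+ t) + Bh t                             ∎)
    where
    Bh : ℕ → Carrier
    Bh t = fromℕ (B t) * h 1
    IH : ∀ t → t ℕ.≤ _ → h t ≈ Bh t
    IH = balancing-recurrence h h0≈0 rec

  module Transition (m : ℕ) (q : Carrier) where
    N : ℕ
    N = 3 ℕ.+ m

    r : Carrier
    r = 1# - fromℕ 6 * q

    Pentry-suc : ∀ k j → j ℕ.≤ suc m → Pentry N q k (suc j) ≈ δ k j q + δ k (suc j) r + δ k (2 ℕ.+ j) q
    Pentry-suc zero j _ = solve 1 (λ x → x := x :+ con (+ 0) :+ con (+ 0)) refl _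
    Pentry-suc (suc zero) j _ = trans (if-≡ᵇ-chain₂ j 0 r q) (sym (+-identityʳ _))
    Pentry-suc (suc (suc k)) j j≤1+m with k ≡ᵇ m in k≡ᵇm
    ... | false = if-≡ᵇ-chain₃ j k q r q
    ... | true with ≡.refl ← ≡ᵇ-true⇒≡ k m k≡ᵇm =
      trans (if-≡ᵇ-chain₂ j m q r) (sym (+-congʳ (trans (+-congʳ δ≈0) (+-identityˡ _))))
      where
      δ≈0 : δ (2 ℕ.+ m) j q ≈ 0#
      δ≈0 = reflexive (≡.cong (λ b → if b then q else 0#) (<⇒≡ᵇ-false (s≤s j≤1+m)))

    Pentry-zero : ∀ k → Pentry N q k 0 ≈ fromℕ 4 * q + δ k 0 (1# - fromℕ 5 * q) + δ k 1 q + δ k (2 ℕ.+ m) q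
    Pentry-zero zero =
      solve 1 (λ q → con (+ 1) :- q := con (+ 4) :* q :+ (con (+ 1) :- con (+ 5) :* q) :+ con (+ 0) :+ con (+ 0))
              refl q
    Pentry-zero (suc zero) = solve 1 (λ q → con (+ 5) :* q := con (+ 4) :* q :+ con (+ 0) :+ q :+ con (+ 0)) refl q
    Pentry-zero (suc (suc k)) rewrite ≡ᵇ-sym m k = last-or-middle (k ≡ᵇ m)
      where
      last-or-middle : ∀ b → (if b then fromℕ 5 * q else fromℕ 4 * q) ≈ fromℕ 4 * q + 0# + 0# + (if b then q else 0#)
      last-or-middle true = solve 1 (λ q → con (+ 5) :* q := con (+ 4) :* q :+ con (+ 0) :+ con (+ 0) :+ q) refl q
      last-or-middle false = solve 1 (λ q → con (+ 4) :* q := con (+ 4) :* q :+ con (+ 0) :+ con (+ 0) :+ con (+ 0)) refl q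

    -- Padding f with f N = 0 turns the last column into an instance of the generic one.
    column-suc : ∀ (f : ℕ → Carrier) → f N ≈ 0# → ∀ j → j ℕ.≤ suc m →
      ΣFin N (λ i → f (toℕ i) * Pentry N q (toℕ i) (suc j)) ≈ f j * q + f (suc j) * r + f (2 ℕ.+ j) * q
    column-suc f fN≈0 j j≤1+m = begin
      ΣFin N (λ i → f (toℕ i) * Pentry N q (toℕ i) (suc j))
        ≈⟨ ΣFin-cong N (λ i → trans (*-congˡ (Pentry-suc (toℕ i) j j≤1+m))
                                    (*-distribˡ-+₃ (f (toℕ i)) _ _ _)) ⟩
      ΣFin N (λ i → term j q i + term (suc j) r i + term (2 ℕ.+ j) q i)
        ≈⟨ ΣFin-+₃ N (term j q) (term (suc j) r) (term (2 ℕ.+ j) q) ⟩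
      ΣFin N (term j q) + ΣFin N (term (suc j) r) + ΣFin N (term (2 ℕ.+ j) q)
        ≈⟨ +-cong (+-cong (ΣFin-*δ-≤ N f j q (ℕ.m≤n⇒m≤1+n (ℕ.m≤n⇒m≤1+n j≤1+m)) fN≈0)
                          (ΣFin-*δ-≤ N f (suc j) r (ℕ.m≤n⇒m≤1+n (s≤s j≤1+m)) fN≈0))
                  (ΣFin-*δ-≤ N f (2 ℕ.+ j) q (s≤s (s≤s j≤1+m)) fN≈0) ⟩
      f j * q + f (suc j) * r + f (2 ℕ.+ j) * q
        ∎
      where
      term : ℕ → Carrier → Fin N → Carrier
      term a x i = f (toℕ i) * δ (toℕ i) a x

    column-zero : ∀ (f : ℕ → Carrier) →
      ΣFin N (λ i → f (toℕ i) * Pentry N q (toℕ i) 0) ≈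
      ΣFin N (λ i → f (toℕ i)) * (fromℕ 4 * q) + f 0 * (1# - fromℕ 5 * q) + f 1 * q + f (2 ℕ.+ m) * q
    column-zero f = begin
      ΣFin N (λ i → f (toℕ i) * Pentry N q (toℕ i) 0)
        ≈⟨ ΣFin-cong N (λ i → trans (*-congˡ (Pentry-zero (toℕ i))) (*-distribˡ-+₄ (f (toℕ i)) _ _ _ _)) ⟩
      ΣFin N (λ i → f (toℕ i) * (fromℕ 4 * q) + term 0 (1# - fromℕ 5 * q) i + term 1 q i + term (2 ℕ.+ m) q i)
        ≈⟨ trans (ΣFin-+ N (λ i → f (toℕ i) * (fromℕ 4 * q) + term 0 (1# - fromℕ 5 * q) i + term 1 q i)
                           (term (2 ℕ.+ m) q))
                 (+-congʳ (ΣFin-+₃ N (λ i → f (toℕ i) * (fromℕ 4 * q)) (term 0 (1# - fromℕ 5 * q)) (term 1 q))) ⟩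
      ΣFin N (λ i → f (toℕ i) * (fromℕ 4 * q)) + ΣFin N (term 0 (1# - fromℕ 5 * q))
        + ΣFin N (term 1 q) + ΣFin N (term (2 ℕ.+ m) q)
        ≈⟨ +-cong (+-cong (+-cong (ΣFin-*ʳ N (λ i → f (toℕ i)) (fromℕ 4 * q))
                                  (ΣFin-*δ N f 0 _ (s≤s z≤n)))
                          (ΣFin-*δ N f 1 q (s≤s (s≤s z≤n))))
                  (ΣFin-*δ N f (2 ℕ.+ m) q ℕ.≤-refl) ⟩
      ΣFin N (λ i → f (toℕ i)) * (fromℕ 4 * q) + f 0 * (1# - fromℕ 5 * q) + f 1 * q + f (2 ℕ.+ m) * q
        ∎
      where
      term : ℕ → Carrier → Fin N → Carrier
      term a x i = f (toℕ i) * δ (toℕ i) a x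

    ΣB≉0 : ¬ (fromℕ (ΣB N) ≈ 0#)
    ΣB≉0 = 1≤n⇒fromℕ≉0 (ΣB-pos (2 ℕ.+ m))

    s : Carrier
    s = fromℕ (ΣB N) ⁻¹

    πB : ℕ → Carrier
    πB k = fromℕ (B (N ∸ k)) * s

    ΣπB≈1 : ΣFin N (λ i → πB (toℕ i)) ≈ 1#
    ΣπB≈1 = trans (ΣFin-*ʳ N (λ i → fromℕ (B (N ∸ toℕ i))) s)
                  (trans (*-congʳ (ΣFin-B N)) (⁻¹-inverse (fromℕ (ΣB N)) ΣB≉0))

    πB-N≈0 : πB N ≈ 0#
    πB-N≈0 = trans (reflexive (≡.cong (λ k → fromℕ (B k) * s) (ℕ.n∸n≡0 N))) (zeroˡ s)

    πB-balanced : ∀ j → j ℕ.≤ suc m → πB j + πB (2 ℕ.+ j) ≈ fromℕ 6 * πB (1 ℕ.+ j)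
    πB-balanced j j≤1+m = begin
      fromℕ (B (N ∸ j)) * s + fromℕ (B t) * s
        ≡⟨ ≡.cong (λ k → fromℕ (B k) * s + fromℕ (B t) * s) (ℕ.+-∸-assoc 2 j≤1+m) ⟩
      fromℕ (B (2 ℕ.+ t)) * s + fromℕ (B t) * s
        ≈⟨ distribʳ _ _ _ ⟨
      (fromℕ (B (2 ℕ.+ t)) + fromℕ (B t)) * s
        ≈⟨ trans (*-congʳ (fromℕ-B-rec t)) (*-assoc _ _ _) ⟩
      fromℕ 6 * (fromℕ (B (1 ℕ.+ t)) * s)
        ≡⟨ ≡.cong (λ k → fromℕ 6 * (fromℕ (B k) * s)) (ℕ.+-∸-assoc 1 j≤1+m) ⟨
      fromℕ 6 * πB (1 ℕ.+ j)
        ∎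
      where
      t = suc m ∸ j

    πB-column-zero : πB 0 ≈ ΣFin N (λ i → πB (toℕ i) * Pentry N q (toℕ i) 0)
    πB-column-zero =
      trans (first-column-balance q (trans ΣπB≈1 (sym (⁻¹-inverse _ ΣB≉0))) 5B≈)
            (sym (column-zero πB))
      where
      5B≈ : fromℕ 5 * fromℕ (B N) ≈ fromℕ (B (2 ℕ.+ m)) + fromℕ (B (N ∸ (2 ℕ.+ m))) + fromℕ 4 * fromℕ (ΣB N)
      5B≈ = begin
        fromℕ 5 * fromℕ (B N)
          ≈⟨ fromℕ-* 5 (B N) ⟨
        fromℕ (5 ℕ.* B N)
          ≡⟨ ≡.cong fromℕ (5*B-suc (2 ℕ.+ m)) ⟩
        fromℕ (B (2 ℕ.+ m) ℕ.+ 1 ℕ.+ 4 ℕ.* ΣB N)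
          ≈⟨ trans (fromℕ-+ (B (2 ℕ.+ m) ℕ.+ 1) (4 ℕ.* ΣB N))
                   (+-cong (fromℕ-+ (B (2 ℕ.+ m)) 1) (fromℕ-* 4 (ΣB N))) ⟩
        fromℕ (B (2 ℕ.+ m)) + fromℕ (B 1) + fromℕ 4 * fromℕ (ΣB N)
          ≡⟨ ≡.cong (λ k → fromℕ (B (2 ℕ.+ m)) + fromℕ (B k) + fromℕ 4 * fromℕ (ΣB N)) (ℕ.m+n∸n≡m 1 m) ⟨
        fromℕ (B (2 ℕ.+ m)) + fromℕ (B (N ∸ (2 ℕ.+ m))) + fromℕ 4 * fromℕ (ΣB N)
          ∎

    πB-steady : IsSteadyState N (P N q) (λ i → πB (toℕ i))
    πB-steady = nonneg , ΣπB≈1 , column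
      where
      nonneg : ∀ i → 0# ≤ πB (toℕ i)
      nonneg i = *-nonneg (0≤fromℕ (B (N ∸ toℕ i))) (0≤x⇒0≤x⁻¹ (0≤fromℕ (ΣB N)) ΣB≉0)

      column : ∀ J → πB (toℕ J) ≈ ΣFin N (λ i → πB (toℕ i) * P N q i J)
      column fzero = πB-column-zero
      column (fsuc J) = trans (balanced⇒column q (πB-balanced (toℕ J) j≤1+m))
                              (sym (column-suc πB πB-N≈0 (toℕ J) j≤1+m))
        where
        j≤1+m = Fin.toℕ≤pred[n] J

    πB≈cob-form : ∀ k → πB k ≈ fromℕ (2 ℕ.* B (N ∸ k)) / fromℕ (cob (N ℕ.+ 1))
    πB≈cob-form k = sym (begin
      fromℕ (2 ℕ.* B (N ∸ k)) * fromℕ (cob (N ℕ.+ 1)) ⁻¹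
        ≈⟨ *-cong (fromℕ-* 2 (B (N ∸ k))) (⁻¹-cong cob≈2ΣB) ⟩
      (fromℕ 2 * fromℕ (B (N ∸ k))) * (fromℕ 2 * fromℕ (ΣB N)) ⁻¹
        ≈⟨ *-cancelˡ-/ (fromℕ (B (N ∸ k))) (1≤n⇒fromℕ≉0 {2} (s≤s z≤n)) ΣB≉0 ⟩
      πB k
        ∎)
      where
      cob≈2ΣB : fromℕ (cob (N ℕ.+ 1)) ≈ fromℕ 2 * fromℕ (ΣB N)
      cob≈2ΣB = trans (reflexive (≡.cong fromℕ (≡.trans (≡.cong cob (ℕ.+-comm N 1)) (cob-suc N))))
                      (fromℕ-* 2 (ΣB N))

    module Uniqueness (q≉0 : ¬ (q ≈ 0#)) {π : Fin N → Carrier} (steady : IsSteadyState N (P N q) π) where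
      πℕ : ℕ → Carrier
      πℕ = extend 0# π

      πℕ-N≈0 : πℕ N ≈ 0#
      πℕ-N≈0 = reflexive (extend-n 0# π)

      π≈πℕ : ∀ i → π i ≈ πℕ (toℕ i)
      π≈πℕ i = reflexive (≡.sym (extend-toℕ 0# π i))

      πℕ-column : ∀ j → j ℕ.≤ suc m →
        πℕ (suc j) ≈ ΣFin N (λ i → πℕ (toℕ i) * Pentry N q (toℕ i) (suc j))
      πℕ-column j j≤1+m = ≡.subst (λ c → πℕ c ≈ ΣFin N (λ i → πℕ (toℕ i) * Pentry N q (toℕ i) c))
                                 (Fin.toℕ-fromℕ< 1+j<N) (column-at (Fin.fromℕ< 1+j<N))
        where
        1+j<N : suc j ℕ.< N
        1+j<N = s≤s (s≤s j≤1+m)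
        column-at : ∀ J → πℕ (toℕ J) ≈ ΣFin N (λ i → πℕ (toℕ i) * P N q i J)
        column-at J = trans (sym (π≈πℕ J))
                        (trans (proj₂ (proj₂ steady) J)
                          (ΣFin-cong N {λ i → π i * P N q i J} {λ i → πℕ (toℕ i) * P N q i J}
                            (λ i → *-congʳ (π≈πℕ i))))

      πℕ-balanced : ∀ j → j ℕ.≤ suc m → πℕ j + πℕ (2 ℕ.+ j) ≈ fromℕ 6 * πℕ (1 ℕ.+ j)
      πℕ-balanced j j≤1+m = column⇒balanced q≉0 (trans (πℕ-column j j≤1+m) (column-suc πℕ πℕ-N≈0 j j≤1+m))

      πℕ≈B* : ∀ k → k ℕ.≤ N → πℕ k ≈ fromℕ (B (N ∸ k)) * πℕ (2 ℕ.+ m)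
      πℕ≈B* k k≤N = ≡.subst (λ c → πℕ c ≈ fromℕ (B (N ∸ k)) * πℕ (2 ℕ.+ m)) (ℕ.m∸[m∸n]≡n k≤N)
        (balancing-recurrence (λ t → πℕ (N ∸ t)) πℕ-N≈0 reversed (N ∸ k) (ℕ.m∸n≤m N k))
        where
        reversed : ∀ t → 2 ℕ.+ t ℕ.≤ N →
          πℕ (N ∸ (2 ℕ.+ t)) + πℕ (N ∸ t) ≈ fromℕ 6 * πℕ (N ∸ (1 ℕ.+ t))
        reversed t (s≤s (s≤s t≤1+m)) =
          ≡.subst₂ (λ a b → πℕ (suc m ∸ t) + πℕ a ≈ fromℕ 6 * πℕ b)
                   (≡.sym (ℕ.+-∸-assoc 2 t≤1+m)) (≡.sym (ℕ.+-∸-assoc 1 t≤1+m))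
                   (πℕ-balanced (suc m ∸ t) (ℕ.m∸n≤m _ t))

      πℕ[2+m]≈s : πℕ (2 ℕ.+ m) ≈ s
      πℕ[2+m]≈s = ⁻¹-unique ΣB≉0 (trans (*-comm _ _) (sym (begin
        1#
          ≈⟨ proj₁ (proj₂ steady) ⟨
        ΣFin N π
          ≈⟨ ΣFin-cong N (λ i → trans (π≈πℕ i) (πℕ≈B* (toℕ i) (Fin.toℕ≤n i))) ⟩
        ΣFin N (λ i → fromℕ (B (N ∸ toℕ i)) * πℕ (2 ℕ.+ m))
          ≈⟨ ΣFin-*ʳ N (λ i → fromℕ (B (N ∸ toℕ i))) (πℕ (2 ℕ.+ m)) ⟩
        ΣFin N (λ i → fromℕ (B (N ∸ toℕ i))) * πℕ (2 ℕ.+ m)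
          ≈⟨ *-congʳ (ΣFin-B N) ⟩
        fromℕ (ΣB N) * πℕ (2 ℕ.+ m)
          ∎)))

      π≈πB : ∀ i → π i ≈ πB (toℕ i)
      π≈πB i = trans (π≈πℕ i) (trans (πℕ≈B* (toℕ i) (Fin.toℕ≤n i)) (*-congˡ πℕ[2+m]≈s))

theorem2p2 : ∀ {c ℓ} (R : RealField c ℓ) → let open RealField R in
    (n : ℕ) → 3 ℕ.≤ n → (q : Carrier) → 0# < q → q ≤ (fromℕ 6) ⁻¹ →
      IsSteadyState n (P n q) (λ i → fromℕ (B (n ∸ toℕ i)) / fromℕ (sumFrom1 n B)) ×
      (∀ (π : Fin n → Carrier) → IsSteadyState n (P n q) π →
        ∀ i → (π i ≈ fromℕ (B (n ∸ toℕ i)) / fromℕ (sumFrom1 n B)) ×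
              (π i ≈ fromℕ (2 ℕ.* B (n ∸ toℕ i)) / fromℕ (cob (n ℕ.+ 1))))
-- The bound q ≤ 1/6 only makes the entries of P(q) nonnegative.
theorem2p2 R (suc (suc (suc m))) (s≤s (s≤s (s≤s z≤n))) q (_ , 0≉q) _ =
  πB-steady , λ π steady i →
    let open Uniqueness q≉0 steady in π≈πB i , trans (π≈πB i) (πB≈cob-form (toℕ i))
  where
  open RealField R
  open OrderedFieldProperties R using (sym; trans)
  open StationaryDistribution R
  open Transition m q

  q≉0 : ¬ (q ≈ 0#)
  q≉0 q≈0 = 0≉q (sym q≈0)
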